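{- For every integer $n \ge 0$ and every complex number $x \neq 0$, with any fixed choices of the square roots $\sqrt{x}$ and $\sqrt{x-4}$ (used consistently on both sides), $$F_{2n+1}(\sqrt{x-4}) = \frac{l_{2n+1}(\sqrt{x})}{\sqrt{x}}, \qquad F_{2n}(\sqrt{x-4}) = \frac{f_{2n}(\sqrt{x})}{\sqrt{x}}\,\sqrt{x-4}.$$
   Context: The Fibonacci polynomials $F_n(x)$ are defined by $F_0(x)=0$, $F_1(x)=1$, $F_n(x) = xF_{n-1}(x)+F_{n-2}(x)$. The polynomials $f_n(x)$ are defined by $f_0(x)=0$, $f_1(x)=1$, $f_n(x) = xf_{n-1}(x) - f_{n-2}(x)$ (so $f_n(x)=U_{n-1}(x/2)$ with $U$ Chebyshev of the second kind). The polynomials $l_n(x)$ are defined by $l_0(x)=2$, $l_1(x)=x$, $l_n(x) = xl_{n-1}(x) - l_{n-2}(x)$ (so $l_n(x)=2T_n(x/2)$). -}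

module Defs where

open import Level using (Level)
open import Data.Nat using (ℕ; zero; suc)
open import Algebra.Bundles using (CommutativeRing)

module Poly {c ℓ : Level} (R : CommutativeRing c ℓ) where
  open CommutativeRing R public

  two four : Carrier
  two = 1# + 1#
  four = two + two

  F : ℕ → Carrier → Carrier
  F zero x = 0#
  F (suc zero) x = 1#
  F (suc (suc n)) x = x * F (suc n) x + F n x

  f : ℕ → Carrier → Carrier
  f zero x = 0#
  f (suc zero) x = 1#
  f (suc (suc n)) x = x * f (suc n) x + - f n x

  l : ℕ → Carrier → Carrier
  l zero x = two
  l (suc zero) x = x
  l (suc (suc n)) x = x * l (suc n) x + - l n x

-- Put s = √x and t = √(x − 4), so that (t² + 2) + 2 = s². Both the odd- and
-- the even-indexed terms of F_n(t) satisfy G_{k+2} = (t² + 2) G_{k+1} − G_k.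
-- Any solution of g_{n+2} = s g_{n+1} − g_n (such as f_n(s) and l_n(s)) has
-- bisections satisfying the same recurrence with multiplier s² − 2 = t² + 2.
-- A solution of a second-order recurrence is determined by its first two
-- terms, and those are checked by hand.
module Submission where

open import Defs
open import Level using (Level)
open import Data.Nat using (ℕ; zero; suc) renaming (_+_ to _+ℕ_; _*_ to _*ℕ_)
open import Data.Nat.Properties as ℕ using ()
open import Data.Product using (_×_; _,_)
open import Algebra.Bundles using (CommutativeRing)
import Algebra.Properties.Group as GroupProperties
import Algebra.Solver.Ring.NaturalCoefficients.Default as NaturalCoefficients
import Relation.Binary.Reasoning.Setoid as SetoidReasoning
open import Relation.Binary.PropositionalEquality as ≡ using (_≡_)

double : ℕ → ℕ
double zero    = zero
double (suc k) = suc (suc (double k))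

double≡2* : ∀ k → double k ≡ 2 *ℕ k
double≡2* zero    = ≡.refl
double≡2* (suc k) = ≡.cong suc (≡.trans (≡.cong suc (double≡2* k)) (≡.sym (ℕ.+-suc k (k +ℕ 0))))

module _ {c ℓ : Level} (R : CommutativeRing c ℓ) where
  open Poly R
  open SetoidReasoning setoid
  open NaturalCoefficients commutativeSemiring
  open GroupProperties +-group using (//-rightDividesˡ; ε⁻¹≈ε) renaming (∙-cancelʳ to +-cancelʳ)

  -- The recurrence g_{k+2} = a g_{k+1} − g_k, with the subtraction moved across.
  Chebyshev : Carrier → (ℕ → Carrier) → Set ℓ
  Chebyshev a g = ∀ k → g (2 +ℕ k) + g k ≈ a * g (1 +ℕ k)

  f-chebyshev : ∀ x → Chebyshev x (λ k → f k x)
  f-chebyshev x k = //-rightDividesˡ (f k x) (x * f (1 +ℕ k) x)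

  l-chebyshev : ∀ x → Chebyshev x (λ k → l k x)
  l-chebyshev x k = //-rightDividesˡ (l k x) (x * l (1 +ℕ k) x)

  chebyshev-*ʳ : ∀ {a g} b → Chebyshev a g → Chebyshev a (λ k → g k * b)
  chebyshev-*ʳ {a} {g} b rec k = begin
    g (2 +ℕ k) * b + g k * b  ≈⟨ distribʳ b (g (2 +ℕ k)) (g k) ⟨
    (g (2 +ℕ k) + g k) * b    ≈⟨ *-congʳ (rec k) ⟩
    (a * g (1 +ℕ k)) * b      ≈⟨ *-assoc a (g (1 +ℕ k)) b ⟩
    a * (g (1 +ℕ k) * b)      ∎

  chebyshev-unique : ∀ {a g h} → Chebyshev a g → Chebyshev a h →
                     g 0 ≈ h 0 → g 1 ≈ h 1 → ∀ k → g k ≈ h k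
  chebyshev-unique {a} {g} {h} recg rech g₀≈h₀ g₁≈h₁ = agree
    where
    agree : ∀ k → g k ≈ h k
    agree zero          = g₀≈h₀
    agree (suc zero)    = g₁≈h₁
    agree (suc (suc k)) = +-cancelʳ (g k) (g (2 +ℕ k)) (h (2 +ℕ k)) (begin
      g (2 +ℕ k) + g k  ≈⟨ recg k ⟩
      a * g (1 +ℕ k)    ≈⟨ *-congˡ (agree (suc k)) ⟩
      a * h (1 +ℕ k)    ≈⟨ rech k ⟨
      h (2 +ℕ k) + h k  ≈⟨ +-congˡ (agree k) ⟨
      h (2 +ℕ k) + g k  ∎)

  chebyshev-skip : ∀ {a d g} → d + two ≈ a * a → Chebyshev a g →
                   ∀ j → g (4 +ℕ j) + g j ≈ d * g (2 +ℕ j)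
  chebyshev-skip {a} {d} {g} d+2≈a² rec j = +-cancelʳ (two * g₂) (g₄ + g₀) (d * g₂) (begin
    (g₄ + g₀) + two * g₂     ≈⟨ solve 3 (λ g₀ g₂ g₄ → (g₄ :+ g₀) :+ (con 1 :+ con 1) :* g₂ := (g₄ :+ g₂) :+ (g₂ :+ g₀)) refl g₀ g₂ g₄ ⟩
    (g₄ + g₂) + (g₂ + g₀)    ≈⟨ +-cong (rec (2 +ℕ j)) (rec j) ⟩
    a * g₃ + a * g₁          ≈⟨ distribˡ a g₃ g₁ ⟨
    a * (g₃ + g₁)            ≈⟨ *-congˡ (rec (1 +ℕ j)) ⟩
    a * (a * g₂)             ≈⟨ *-assoc a a g₂ ⟨
    (a * a) * g₂             ≈⟨ *-congʳ d+2≈a² ⟨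
    (d + two) * g₂           ≈⟨ distribʳ g₂ d two ⟩
    d * g₂ + two * g₂        ∎)
    where
    g₀ = g j
    g₁ = g (1 +ℕ j)
    g₂ = g (2 +ℕ j)
    g₃ = g (3 +ℕ j)
    g₄ = g (4 +ℕ j)

  F-skip : ∀ x j → F (4 +ℕ j) x + F j x ≈ (x * x + two) * F (2 +ℕ j) x
  F-skip x j = solve 3 (λ x a b → x :* (x :* (x :* b :+ a) :+ b) :+ (x :* b :+ a) :+ a
                                  := (x :* x :+ (con 1 :+ con 1)) :* (x :* b :+ a))
                       refl x (F j x) (F (1 +ℕ j) x)

  x*u≈1⇒x*a≈b⇒a≈b*u : ∀ {x u a b} → x * u ≈ 1# → x * a ≈ b → a ≈ b * u
  x*u≈1⇒x*a≈b⇒a≈b*u {x} {u} {a} {b} xu≈1 xa≈b = begin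
    a             ≈⟨ *-identityˡ a ⟨
    1# * a        ≈⟨ *-congʳ xu≈1 ⟨
    (x * u) * a   ≈⟨ solve 3 (λ x u a → (x :* u) :* a := (x :* a) :* u) refl x u a ⟩
    (x * a) * u   ≈⟨ *-congʳ xa≈b ⟩
    b * u         ∎

  module _ (x s t u : Carrier) (s²≈x : s * s ≈ x) (t²≈x-4 : t * t ≈ x + - four) (su≈1 : s * u ≈ 1#) where
    t²+4≈s² : t * t + four ≈ s * s
    t²+4≈s² = trans (+-congʳ t²≈x-4) (trans (//-rightDividesˡ four x) (sym s²≈x))

    t²+2+2≈s² : (t * t + two) + two ≈ s * s
    t²+2+2≈s² = trans (+-assoc (t * t) two two) t²+4≈s²

    s*F₃≈l₃ : s * F 3 t ≈ l 3 s
    s*F₃≈l₃ = +-cancelʳ (s + two * s) (s * F 3 t) (l 3 s) (begin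
      s * F 3 t + (s + two * s)  ≈⟨ solve 2 (λ s t → s :* (t :* (t :* con 1 :+ con 0) :+ con 1) :+ (s :+ (con 1 :+ con 1) :* s)
                                                   := s :* (t :* t :+ ((con 1 :+ con 1) :+ (con 1 :+ con 1)))) refl s t ⟩
      s * (t * t + four)         ≈⟨ *-congˡ t²+4≈s² ⟩
      s * (s * s)                ≈⟨ *-congˡ (l-chebyshev s 0) ⟨
      s * (l 2 s + two)          ≈⟨ solve 2 (λ s a → s :* (a :+ (con 1 :+ con 1)) := s :* a :+ (con 1 :+ con 1) :* s) refl s (l 2 s) ⟩
      s * l 2 s + two * s        ≈⟨ +-congʳ (l-chebyshev s 1) ⟨
      (l 3 s + s) + two * s      ≈⟨ +-assoc (l 3 s) s (two * s) ⟩
      l 3 s + (s + two * s)      ∎)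

    F₂≈f₂*u*t : F 2 t ≈ (f 2 s * u) * t
    F₂≈f₂*u*t = begin
      F 2 t                       ≈⟨ solve 1 (λ t → t :* con 1 :+ con 0 := con 1 :* t) refl t ⟩
      1# * t                      ≈⟨ *-congʳ su≈1 ⟨
      (s * u) * t                 ≈⟨ solve 3 (λ s u t → (s :* u) :* t := ((s :* con 1 :+ con 0) :* u) :* t) refl s u t ⟩
      ((s * 1# + 0#) * u) * t     ≈⟨ *-congʳ (*-congʳ (+-congˡ ε⁻¹≈ε)) ⟨
      (f 2 s * u) * t             ∎

    F-odd : ∀ k → F (suc (double k)) t ≈ l (suc (double k)) s * u
    F-odd = chebyshev-unique
      (λ k → F-skip t (suc (double k)))
      (chebyshev-*ʳ u (λ k → chebyshev-skip t²+2+2≈s² (l-chebyshev s) (suc (double k))))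
      (sym su≈1)
      (x*u≈1⇒x*a≈b⇒a≈b*u su≈1 s*F₃≈l₃)

    F-even : ∀ k → F (double k) t ≈ (f (double k) s * u) * t
    F-even = chebyshev-unique
      (λ k → F-skip t (double k))
      (chebyshev-*ʳ t (chebyshev-*ʳ u (λ k → chebyshev-skip t²+2+2≈s² (f-chebyshev s) (double k))))
      (sym (trans (*-congʳ (zeroˡ u)) (zeroˡ t)))
      F₂≈f₂*u*t

proposition1 : {c ℓ : Level} (R : CommutativeRing c ℓ) →
    let open Poly R in
    (n : ℕ) (x sx sx-4 sx⁻¹ : Carrier) →
    sx * sx ≈ x → sx-4 * sx-4 ≈ x + - four → sx * sx⁻¹ ≈ 1# →
    (F (1 +ℕ 2 *ℕ n) sx-4 ≈ l (1 +ℕ 2 *ℕ n) sx * sx⁻¹)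
    × (F (2 *ℕ n) sx-4 ≈ (f (2 *ℕ n) sx * sx⁻¹) * sx-4)
proposition1 R n x s t u s²≈x t²≈x-4 su≈1 rewrite ≡.sym (double≡2* n) =
  F-odd R x s t u s²≈x t²≈x-4 su≈1 n , F-even R x s t u s²≈x t²≈x-4 su≈1 n
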